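{- Let $C=c_0\dots c_{m-1}c_0$ and $D=(0)(1)\dots(n-1)(0)$ be reflexive digraph cycles with $D$ non-contractible. For any homomorphism $\phi\in\mathrm{Hom}(C,D)$ and any cutback $P=c_a\dots c_b$ of $C$ with respect to $\phi$, there is a path of up edges in $\mathrm{Hom}(C,D)$ from $\phi$ to the homomorphism $\phi'$ obtained from $\phi$ by setting $\phi'(c_i)=\phi(c_a)$ for all $c_i\in P$ (and $\phi'=\phi$ elsewhere).
   Context: Digraphs, reflexive, digraph cycles as usual; $C$ has edges $c_ic_{i+1}$ (indices mod $m$), $D$ has vertex set $\mathbb{Z}_n$ with edges $j(j+1)$; $D$ non-contractible means length at least 4 or a directed 3-cycle. $\mathrm{Hom}(C,D)$ is the digraph on homomorphisms $C\to D$ with $\phi\to\phi'$ iff $u\to v$ implies $\phi(u)\to\phi'(v)$ for all $u,v$. Under $\phi$, edge $c_jc_{j+1}$ is increasing, stationary or decreasing according as $\phi(c_{j+1})-\phi(c_j)$ is $1,0,-1$ in $\mathbb{Z}_n$; the increase of a subpath $c_a\dots c_i$ (following the cyclic order) is the number of its increasing edges minus the number of its decreasing edges. A subpath $P=c_a\dots c_b$ is a cutback if its increase is $0$ and the increase of $c_a\dots c_i$ is negative for all $i\in\{a+1,\dots,b-1\}$. For adjacent $\phi,\phi'$ and a vertex $c$, $c$ moves up if $\phi'(c)=\phi(c)+1$; $\phi\phi'$ is an up edge (from $\phi$ to $\phi'$) if they are adjacent and every vertex $c$ with $\phi'(c)\neq\phi(c)$ moves up. A path of up edges from $\phi$ to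 $\phi'$ is a sequence $\phi=\phi_0,\dots,\phi_k=\phi'$ with each $\phi_j\phi_{j+1}$ an up edge from $\phi_j$ to $\phi_{j+1}$. -}

module Defs where

open import Data.Nat using (ℕ; zero; suc; _+_; _≤_; _<_; NonZero)
open import Data.Nat.DivMod using (_mod_)
open import Data.Fin using (Fin; toℕ)
open import Data.Fin.Properties using (_≟_)
open import Data.Bool using (Bool; true; false)
open import Data.Integer as ℤ using (ℤ; +_; -[1+_])
open import Data.Product using (Σ; _×_; ∃-syntax)
open import Data.Sum using (_⊎_)
open import Relation.Binary.PropositionalEquality using (_≡_)
open import Relation.Nullary using (¬_; yes; no)

shift : (k : ℕ) .{{_ : NonZero k}} → Fin k → ℕ → Fin k
shift k i t = (toℕ i + t) mod k

nxt : (k : ℕ) .{{_ : NonZero k}} → Fin k → Fin k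
nxt k i = shift k i 1

-- A reflexive digraph cycle on vertices Fin k (= Z_k) with one arc between
-- i and i+1 for each i; dir i = true means the arc is i → i+1,
-- dir i = false means the arc is i+1 → i.
Arc : (k : ℕ) .{{_ : NonZero k}} → (Fin k → Bool) → Fin k → Fin k → Set
Arc k dir u v = ((v ≡ nxt k u) × (dir u ≡ true)) ⊎ ((u ≡ nxt k v) × (dir v ≡ false))

Edge : (k : ℕ) .{{_ : NonZero k}} → (Fin k → Bool) → Fin k → Fin k → Set
Edge k dir u v = (u ≡ v) ⊎ Arc k dir u v

NonContractible : (n : ℕ) .{{_ : NonZero n}} → (Fin n → Bool) → Set
NonContractible n dD = (4 ≤ n) ⊎ ((n ≡ 3) × ((∀ j → dD j ≡ true) ⊎ (∀ j → dD j ≡ false)))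

module _ (m n : ℕ) .{{_ : NonZero m}} .{{_ : NonZero n}}
         (dC : Fin m → Bool) (dD : Fin n → Bool) where

  IsHom : (Fin m → Fin n) → Set
  IsHom φ = ∀ u v → Edge m dC u v → Edge n dD (φ u) (φ v)

  HomEdge : (Fin m → Fin n) → (Fin m → Fin n) → Set
  HomEdge φ ψ = ∀ u v → Edge m dC u v → Edge n dD (φ u) (ψ v)

  Adjacent : (Fin m → Fin n) → (Fin m → Fin n) → Set
  Adjacent φ ψ = HomEdge φ ψ ⊎ HomEdge ψ φ

  UpEdge : (Fin m → Fin n) → (Fin m → Fin n) → Set
  UpEdge φ ψ = IsHom φ × IsHom ψ × Adjacent φ ψ
             × (∀ c → ¬ (ψ c ≡ φ c) → ψ c ≡ nxt n (φ c))

  data UpPath : (Fin m → Fin n) → (Fin m → Fin n) → Set where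
    done : ∀ {φ} → UpPath φ φ
    step : ∀ {φ ψ χ} → UpEdge φ ψ → UpPath ψ χ → UpPath φ χ

-- contribution of the edge c_j c_{j+1} under φ: +1 increasing, 0 stationary,
-- -1 decreasing (0 otherwise, which never happens for a homomorphism)
edgeIncr : (m n : ℕ) .{{_ : NonZero m}} .{{_ : NonZero n}} →
           (Fin m → Fin n) → Fin m → ℤ
edgeIncr m n φ j with φ (nxt m j) ≟ nxt n (φ j)
... | yes _ = + 1
... | no _ with φ (nxt m j) ≟ φ j
...   | yes _ = + 0
...   | no _ with φ j ≟ nxt n (φ (nxt m j))
...     | yes _ = -[1+ 0 ]
...     | no _ = + 0

increase : (m n : ℕ) .{{_ : NonZero m}} .{{_ : NonZero n}} →
           (Fin m → Fin n) → Fin m → ℕ → ℤ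
increase m n φ a zero = + 0
increase m n φ a (suc k) = increase m n φ a k ℤ.+ edgeIncr m n φ (shift m a k)

-- the subpath P = c_a … c_b with b = a + k (mod m), k < m, is a cutback w.r.t. φ
Cutback : (m n : ℕ) .{{_ : NonZero m}} .{{_ : NonZero n}} →
          (Fin m → Fin n) → Fin m → ℕ → Set
Cutback m n φ a k =
  (k < m) × (increase m n φ a k ≡ + 0)
  × (∀ i → 1 ≤ i → i < k → increase m n φ a i ℤ.< + 0)

OnPath : (m : ℕ) .{{_ : NonZero m}} → Fin m → ℕ → Fin m → Set
OnPath m a k u = ∃[ t ] ((t ≤ k) × (shift m a t ≡ u))

-- Along a cutback c_a … c_{a+k} the negated increase is the depth of c_{a+t} below φ(c_a):
-- it starts and ends at 0, stays non-negative, and changes by at most one per edge,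
-- in step with φ. Clipping all depths at j therefore gives a homomorphism for every j,
-- clipping at k is φ and clipping at 0 is φ'. Passing from clipping at j+1 to clipping at j moves
-- exactly the vertices lying j+1 below φ(c_a), all by one step up, which is an up edge.
module Submission where

open import Defs
open import Data.Nat using (ℕ; zero; suc; _+_; _*_; _∸_; _≤_; _<_; pred; NonZero; _%_; z≤n; s≤s; _≤?_; _<?_)
open import Data.Nat.Properties hiding (_≟_)
open import Algebra.Properties.CommutativeSemigroup +-commutativeSemigroup using (x∙yz≈y∙xz; xy∙z≈y∙xz)
open import Data.Nat.DivMod using (m%n<n; m<n⇒m%n≡m; %-distribˡ-+; m%n%n≡m%n; [m+n]%n≡m%n; [m+kn]%n≡m%n; n%n≡0)
open import Data.Fin using (Fin; toℕ)
open import Data.Fin.Properties using (toℕ-fromℕ<; toℕ-injective; toℕ<n; _≟_)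
open import Data.Bool using (Bool; true; false)
open import Data.Integer as ℤ using (ℤ; +_; -[1+_]; ∣_∣)
import Data.Integer.Properties as ℤ
open import Data.Product using (_×_; _,_; proj₁; proj₂)
open import Data.Sum using (_⊎_; inj₁; inj₂)
open import Relation.Nullary using (¬_; Dec; yes; no; contradiction)
open import Relation.Binary.PropositionalEquality

[m%n+k]%n≡[m+k]%n : ∀ x u N .{{_ : NonZero N}} → (x % N + u) % N ≡ (x + u) % N
[m%n+k]%n≡[m+k]%n x u N = begin
  (x % N + u) % N          ≡⟨ %-distribˡ-+ (x % N) u N ⟩
  (x % N % N + u % N) % N  ≡⟨ cong (λ w → (w + u % N) % N) (m%n%n≡m%n x N) ⟩
  (x % N + u % N) % N      ≡⟨ %-distribˡ-+ x u N ⟨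
  (x + u) % N              ∎
  where open ≡-Reasoning

[m+k%n]%n≡[m+k]%n : ∀ x u N .{{_ : NonZero N}} → (x + u % N) % N ≡ (x + u) % N
[m+k%n]%n≡[m+k]%n x u N = begin
  (x + u % N) % N  ≡⟨ cong (_% N) (+-comm x (u % N)) ⟩
  (u % N + x) % N  ≡⟨ [m%n+k]%n≡[m+k]%n u x N ⟩
  (u + x) % N      ≡⟨ cong (_% N) (+-comm u x) ⟩
  (x + u) % N      ∎
  where open ≡-Reasoning

module Cyclic (N : ℕ) .{{_ : NonZero N}} where

  toℕ-shift : ∀ x t → toℕ (shift N x t) ≡ (toℕ x + t) % N
  toℕ-shift x t = toℕ-fromℕ< (m%n<n (toℕ x + t) N)

  shift-shift : ∀ x t u → shift N (shift N x t) u ≡ shift N x (t + u)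
  shift-shift x t u = toℕ-injective (begin
    toℕ (shift N (shift N x t) u)  ≡⟨ toℕ-shift (shift N x t) u ⟩
    (toℕ (shift N x t) + u) % N    ≡⟨ cong (λ w → (w + u) % N) (toℕ-shift x t) ⟩
    ((toℕ x + t) % N + u) % N      ≡⟨ [m%n+k]%n≡[m+k]%n (toℕ x + t) u N ⟩
    (toℕ x + t + u) % N            ≡⟨ cong (_% N) (+-assoc (toℕ x) t u) ⟩
    (toℕ x + (t + u)) % N          ≡⟨ toℕ-shift x (t + u) ⟨
    toℕ (shift N x (t + u))        ∎)
    where open ≡-Reasoning

  shift-nxt : ∀ x t → shift N (nxt N x) t ≡ shift N x (suc t)
  shift-nxt x = shift-shift x 1

  nxt-shift : ∀ x t → nxt N (shift N x t) ≡ shift N x (suc t)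
  nxt-shift x t = trans (shift-shift x t 1) (cong (shift N x) (+-comm t 1))

  shift-multiple : ∀ x r → shift N x (r * N) ≡ x
  shift-multiple x r = toℕ-injective (begin
    toℕ (shift N x (r * N))  ≡⟨ toℕ-shift x (r * N) ⟩
    (toℕ x + r * N) % N      ≡⟨ [m+kn]%n≡m%n (toℕ x) r N ⟩
    toℕ x % N                ≡⟨ m<n⇒m%n≡m (toℕ<n x) ⟩
    toℕ x                    ∎)
    where open ≡-Reasoning

  shift-zero : ∀ x → shift N x 0 ≡ x
  shift-zero x = shift-multiple x 0

  back^ : ℕ → Fin N → Fin N
  back^ r x = shift N x (r * pred N)

  back^-shift : ∀ r x → back^ r (shift N x r) ≡ x
  back^-shift r x = begin
    shift N (shift N x r) (r * pred N)  ≡⟨ shift-shift x r (r * pred N) ⟩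
    shift N x (r + r * pred N)          ≡⟨ cong (shift N x) (*-suc r (pred N)) ⟨
    shift N x (r * suc (pred N))        ≡⟨ cong (λ w → shift N x (r * w)) (suc-pred N) ⟩
    shift N x (r * N)                   ≡⟨ shift-multiple x r ⟩
    x                                   ∎
    where open ≡-Reasoning

  shift⇒back^ : ∀ {x r y} → shift N x r ≡ y → x ≡ back^ r y
  shift⇒back^ {x} {r} refl = sym (back^-shift r x)

  offset : Fin N → Fin N → ℕ
  offset a u = (toℕ u + (N ∸ toℕ a)) % N

  a+[N∸a]≡N : ∀ a → toℕ a + (N ∸ toℕ a) ≡ N
  a+[N∸a]≡N a = m+[n∸m]≡n (<⇒≤ (toℕ<n a))

  shift-offset : ∀ a u → shift N a (offset a u) ≡ u
  shift-offset a u = toℕ-injective (begin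
    toℕ (shift N a (offset a u))        ≡⟨ toℕ-shift a (offset a u) ⟩
    (toℕ a + offset a u) % N            ≡⟨ [m+k%n]%n≡[m+k]%n (toℕ a) (toℕ u + (N ∸ toℕ a)) N ⟩
    (toℕ a + (toℕ u + (N ∸ toℕ a))) % N ≡⟨ cong (_% N) (x∙yz≈y∙xz (toℕ a) (toℕ u) _) ⟩
    (toℕ u + (toℕ a + (N ∸ toℕ a))) % N ≡⟨ cong (λ w → (toℕ u + w) % N) (a+[N∸a]≡N a) ⟩
    (toℕ u + N) % N                     ≡⟨ [m+n]%n≡m%n (toℕ u) N ⟩
    toℕ u % N                           ≡⟨ m<n⇒m%n≡m (toℕ<n u) ⟩
    toℕ u                               ∎)
    where open ≡-Reasoning

  offset<N : ∀ a u → offset a u < N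
  offset<N a u = m%n<n (toℕ u + (N ∸ toℕ a)) N

  offset-shift : ∀ a t → offset a (shift N a t) ≡ t % N
  offset-shift a t = begin
    (toℕ (shift N a t) + (N ∸ toℕ a)) % N  ≡⟨ cong (λ w → (w + (N ∸ toℕ a)) % N) (toℕ-shift a t) ⟩
    ((toℕ a + t) % N + (N ∸ toℕ a)) % N    ≡⟨ [m%n+k]%n≡[m+k]%n (toℕ a + t) (N ∸ toℕ a) N ⟩
    (toℕ a + t + (N ∸ toℕ a)) % N          ≡⟨ cong (_% N) (xy∙z≈y∙xz (toℕ a) t _) ⟩
    (t + (toℕ a + (N ∸ toℕ a))) % N        ≡⟨ cong (λ w → (t + w) % N) (a+[N∸a]≡N a) ⟩
    (t + N) % N                            ≡⟨ [m+n]%n≡m%n t N ⟩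
    t % N                                  ∎
    where open ≡-Reasoning

  offset-nxt : ∀ a u → offset a (nxt N u) ≡ suc (offset a u) % N
  offset-nxt a u = begin
    offset a (nxt N u)                          ≡⟨ cong (λ w → offset a (nxt N w)) (shift-offset a u) ⟨
    offset a (nxt N (shift N a (offset a u)))   ≡⟨ cong (offset a) (nxt-shift a (offset a u)) ⟩
    offset a (shift N a (suc (offset a u)))     ≡⟨ offset-shift a (suc (offset a u)) ⟩
    suc (offset a u) % N                        ∎
    where open ≡-Reasoning

∣i∣≡1+∣i+1∣ : ∀ i → i ℤ.+ + 1 ℤ.≤ + 0 → ∣ i ∣ ≡ suc ∣ i ℤ.+ + 1 ∣
∣i∣≡1+∣i+1∣ (+ zero) (ℤ.+≤+ ())
∣i∣≡1+∣i+1∣ (+ suc _) (ℤ.+≤+ ())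
∣i∣≡1+∣i+1∣ -[1+ zero ] _ = refl
∣i∣≡1+∣i+1∣ -[1+ suc _ ] _ = refl

∣i-1∣≡1+∣i∣ : ∀ i → i ℤ.≤ + 0 → ∣ i ℤ.+ -[1+ 0 ] ∣ ≡ suc ∣ i ∣
∣i-1∣≡1+∣i∣ (+ zero) _ = refl
∣i-1∣≡1+∣i∣ (+ suc _) (ℤ.+≤+ ())
∣i-1∣≡1+∣i∣ -[1+ x ] _ = cong (λ w → suc (suc w)) (+-identityʳ x)

module _ {n : ℕ} .{{_ : NonZero n}} where

  open Cyclic n

  -- A step x → y of a walk in the cycle on Fin n, with p and q the depths of x and y below a fixed vertex.
  data DepthStep (x y : Fin n) (p q : ℕ) : Set where
    ascend  : y ≡ nxt n x → p ≡ suc q → DepthStep x y p q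
    level   : y ≡ x → p ≡ q → DepthStep x y p q
    descend : x ≡ nxt n y → q ≡ suc p → DepthStep x y p q

  DepthStep-≤ : ∀ {x y p q} → DepthStep x y p q → q ≤ suc p
  DepthStep-≤ {p = p} {q} (ascend _ refl) = ≤-trans (n≤1+n q) (n≤1+n p)
  DepthStep-≤ {p = p} (level _ refl) = n≤1+n p
  DepthStep-≤ (descend _ refl) = ≤-refl

  DepthStep-level : ∀ {x y p q} → DepthStep x y p q → shift n x p ≡ shift n y q
  DepthStep-level {x} {q = q} (ascend refl refl) = sym (shift-nxt x q)
  DepthStep-level (level refl refl) = refl
  DepthStep-level {y = y} {p} (descend refl refl) = shift-nxt y p

  Compatible : Fin n → Fin n → ℕ → ℕ → Set
  Compatible x y p q = (p ≡ 0 × q ≡ 0) ⊎ DepthStep x y p q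

  Compatible-sym : ∀ {x y p q} → Compatible x y p q → Compatible y x q p
  Compatible-sym (inj₁ (p≡0 , q≡0)) = inj₁ (q≡0 , p≡0)
  Compatible-sym (inj₂ (ascend e d)) = inj₂ (descend e d)
  Compatible-sym (inj₂ (level e d)) = inj₂ (level (sym e) (sym d))
  Compatible-sym (inj₂ (descend e d)) = inj₂ (ascend e d)

  MergedOrFixed : Fin n → Fin n → Fin n → Fin n → Set
  MergedOrFixed x y x′ y′ = (x′ ≡ y′) ⊎ (x′ ≡ x × y′ ≡ y)

  MergedOrFixed-sym : ∀ {x y x′ y′} → MergedOrFixed x y x′ y′ → MergedOrFixed y x y′ x′
  MergedOrFixed-sym (inj₁ e) = inj₁ (sym e)
  MergedOrFixed-sym (inj₂ (ex , ey)) = inj₂ (ey , ex)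

  shift-zero-∸ : ∀ x {p j} → p ≤ j → shift n x (p ∸ j) ≡ x
  shift-zero-∸ x p≤j = trans (cong (shift n x) (m≤n⇒m∸n≡0 p≤j)) (shift-zero x)

  clip-ascend : ∀ j {x y q} → y ≡ nxt n x →
                MergedOrFixed x y (shift n x (suc q ∸ j)) (shift n y (q ∸ j))
  clip-ascend j {x} {y} {q} y≡x+1 with j ≤? q
  ... | yes j≤q = inj₁ (begin
    shift n x (suc q ∸ j)      ≡⟨ cong (shift n x) (+-∸-assoc 1 j≤q) ⟩
    shift n x (suc (q ∸ j))    ≡⟨ shift-nxt x (q ∸ j) ⟨
    shift n (nxt n x) (q ∸ j)  ≡⟨ cong (λ w → shift n w (q ∸ j)) y≡x+1 ⟨
    shift n y (q ∸ j)          ∎)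
    where open ≡-Reasoning
  ... | no j≰q = inj₂ (shift-zero-∸ x (≰⇒> j≰q) , shift-zero-∸ y (<⇒≤ (≰⇒> j≰q)))

  clip-compatible : ∀ j {x y p q} → Compatible x y p q →
                    MergedOrFixed x y (shift n x (p ∸ j)) (shift n y (q ∸ j))
  clip-compatible j {x} {y} (inj₁ (refl , refl)) = inj₂ (shift-zero-∸ x (z≤n {j}) , shift-zero-∸ y (z≤n {j}))
  clip-compatible j (inj₂ (ascend e refl)) = clip-ascend j e
  clip-compatible j (inj₂ (level refl refl)) = inj₁ refl
  clip-compatible j (inj₂ (descend e refl)) = MergedOrFixed-sym (clip-ascend j e)

  Edge-MergedOrFixed : ∀ {dD x y x′ y′} → Edge n dD x y → MergedOrFixed x y x′ y′ → Edge n dD x′ y′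
  Edge-MergedOrFixed _ (inj₁ refl) = inj₁ refl
  Edge-MergedOrFixed e (inj₂ (refl , refl)) = e

module _ (m n : ℕ) .{{_ : NonZero m}} .{{_ : NonZero n}}
         (dC : Fin m → Bool) (dD : Fin n → Bool) where

  ≗-upEdge : ∀ {χ ψ} → IsHom m n dC dD χ → (∀ w → ψ w ≡ χ w) → UpEdge m n dC dD χ ψ
  ≗-upEdge {χ} {ψ} hχ ψ≗χ = hχ , hψ , inj₁ χ→ψ , λ w ψw≢χw → contradiction (ψ≗χ w) ψw≢χw
    where
      hψ : IsHom m n dC dD ψ
      hψ u v e = subst₂ (Edge n dD) (sym (ψ≗χ u)) (sym (ψ≗χ v)) (hχ u v e)
      χ→ψ : HomEdge m n dC dD χ ψ
      χ→ψ u v e = subst (Edge n dD (χ u)) (sym (ψ≗χ v)) (hχ u v e)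

  -- The arc between z and z+1 in D orients the edge of Hom(C,D).
  uniform-upEdge : ∀ {χ ψ} → IsHom m n dC dD χ → IsHom m n dC dD ψ → (z : Fin n) →
                   (∀ w → (ψ w ≡ χ w) ⊎ (χ w ≡ z × ψ w ≡ nxt n z)) → UpEdge m n dC dD χ ψ
  uniform-upEdge {χ} {ψ} hχ hψ z moves = hχ , hψ , adjacent (dD z) refl , up
    where
      adjacent : ∀ b → dD z ≡ b → Adjacent m n dC dD χ ψ
      adjacent true dz = inj₁ λ u v e → forward u v e (moves u) (moves v)
        where
          forward : ∀ u v → Edge m dC u v → _ → _ → Edge n dD (χ u) (ψ v)
          forward u v e _ (inj₁ ψv≡χv) = subst (Edge n dD (χ u)) (sym ψv≡χv) (hχ u v e)
          forward u v e (inj₁ ψu≡χu) (inj₂ _) = subst (λ x → Edge n dD x (ψ v)) ψu≡χu (hψ u v e)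
          forward u v e (inj₂ (χu≡z , _)) (inj₂ (_ , ψv≡z+1)) =
            subst₂ (Edge n dD) (sym χu≡z) (sym ψv≡z+1) (inj₂ (inj₁ (refl , dz)))
      adjacent false dz = inj₂ λ u v e → backward u v e (moves u) (moves v)
        where
          backward : ∀ u v → Edge m dC u v → _ → _ → Edge n dD (ψ u) (χ v)
          backward u v e (inj₁ ψu≡χu) _ = subst (λ x → Edge n dD x (χ v)) (sym ψu≡χu) (hχ u v e)
          backward u v e (inj₂ _) (inj₁ ψv≡χv) = subst (Edge n dD (ψ u)) ψv≡χv (hψ u v e)
          backward u v e (inj₂ (_ , ψu≡z+1)) (inj₂ (χv≡z , _)) =
            subst₂ (Edge n dD) (sym ψu≡z+1) (sym χv≡z) (inj₂ (inj₂ (refl , dz)))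
      up : ∀ w → ¬ ψ w ≡ χ w → ψ w ≡ nxt n (χ w)
      up w ψw≢χw with moves w
      ... | inj₁ ψw≡χw = contradiction ψw≡χw ψw≢χw
      ... | inj₂ (χw≡z , ψw≡z+1) = trans ψw≡z+1 (cong (nxt n) (sym χw≡z))

  UpPath-++ : ∀ {φ ψ χ} → UpPath m n dC dD φ ψ → UpPath m n dC dD ψ χ → UpPath m n dC dD φ χ
  UpPath-++ done q = q
  UpPath-++ (step e p) q = step e (UpPath-++ p q)

  descending-upPath : (g : ℕ → Fin m → Fin n) → (∀ j → UpEdge m n dC dD (g (suc j)) (g j)) →
                      ∀ j → UpPath m n dC dD (g j) (g 0)
  descending-upPath g up zero = done
  descending-upPath g up (suc j) = step (up j) (descending-upPath g up j)

  C-arc : ∀ j → Edge m dC j (nxt m j) ⊎ Edge m dC (nxt m j) j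
  C-arc j with dC j
  ... | true = inj₁ (inj₂ (inj₁ (refl , refl)))
  ... | false = inj₂ (inj₂ (inj₂ (refl , refl)))

  edge-steps : ∀ {x y} → Edge n dD x y ⊎ Edge n dD y x → (y ≡ x) ⊎ (y ≡ nxt n x) ⊎ (x ≡ nxt n y)
  edge-steps (inj₁ (inj₁ x≡y)) = inj₁ (sym x≡y)
  edge-steps (inj₁ (inj₂ (inj₁ (y≡x+1 , _)))) = inj₂ (inj₁ y≡x+1)
  edge-steps (inj₁ (inj₂ (inj₂ (x≡y+1 , _)))) = inj₂ (inj₂ x≡y+1)
  edge-steps (inj₂ (inj₁ y≡x)) = inj₁ y≡x
  edge-steps (inj₂ (inj₂ (inj₁ (x≡y+1 , _)))) = inj₂ (inj₂ x≡y+1)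
  edge-steps (inj₂ (inj₂ (inj₂ (y≡x+1 , _)))) = inj₂ (inj₁ y≡x+1)

  edgeIncr-cases : ∀ {φ} → IsHom m n dC dD φ → ∀ j →
                   (φ (nxt m j) ≡ nxt n (φ j) × edgeIncr m n φ j ≡ + 1)
                 ⊎ (φ (nxt m j) ≡ φ j × edgeIncr m n φ j ≡ + 0)
                 ⊎ (φ j ≡ nxt n (φ (nxt m j)) × edgeIncr m n φ j ≡ -[1+ 0 ])
  edgeIncr-cases {φ} hom j with φ (nxt m j) ≟ nxt n (φ j)
  ... | yes inc = inj₁ (inc , refl)
  ... | no ¬inc with φ (nxt m j) ≟ φ j
  ...   | yes sta = inj₂ (inj₁ (sta , refl))
  ...   | no ¬sta with φ j ≟ nxt n (φ (nxt m j))
  ...     | yes dec = inj₂ (inj₂ (dec , refl))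
  ...     | no ¬dec with edge-steps (Data.Sum.map (hom _ _) (hom _ _) (C-arc j))
  ...       | inj₁ sta = contradiction sta ¬sta
  ...       | inj₂ (inj₁ inc) = contradiction inc ¬inc
  ...       | inj₂ (inj₂ dec) = contradiction dec ¬dec

module Cutback-flattening (m n : ℕ) .{{_ : NonZero m}} .{{_ : NonZero n}}
  (dC : Fin m → Bool) (dD : Fin n → Bool)
  (φ : Fin m → Fin n) (hom : IsHom m n dC dD φ)
  (a : Fin m) (k : ℕ) (cutback : Cutback m n φ a k) where

  module ℤm = Cyclic m
  module ℤn = Cyclic n
  open ℤn using (back^)

  s : ℕ → Fin m
  s = shift m a

  incr : ℕ → ℤ
  incr = increase m n φ a

  depth : ℕ → ℕ
  depth t = ∣ incr t ∣

  k<m : k < m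
  k<m = proj₁ cutback

  increase-nonpos : ∀ {t} → t ≤ k → incr t ℤ.≤ + 0
  increase-nonpos {zero} _ = ℤ.+≤+ z≤n
  increase-nonpos {suc t} t<k with m≤n⇒m<n∨m≡n t<k
  ... | inj₁ t+1<k = ℤ.<⇒≤ (proj₂ (proj₂ cutback) (suc t) (s≤s z≤n) t+1<k)
  ... | inj₂ refl = ℤ.≤-reflexive (proj₁ (proj₂ cutback))

  depth-step : ∀ {t} → t < k → DepthStep (φ (s t)) (φ (nxt m (s t))) (depth t) (depth (suc t))
  depth-step {t} t<k with edgeIncr-cases m n dC dD hom (s t)
  ... | inj₁ (inc , δ) = ascend inc (trans
    (∣i∣≡1+∣i+1∣ (incr t) (subst (λ w → incr t ℤ.+ w ℤ.≤ + 0) δ (increase-nonpos t<k)))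
    (cong (λ w → suc ∣ incr t ℤ.+ w ∣) (sym δ)))
  ... | inj₂ (inj₁ (sta , δ)) = level sta (sym (trans
    (cong (λ w → ∣ incr t ℤ.+ w ∣) δ) (cong ∣_∣ (ℤ.+-identityʳ (incr t)))))
  ... | inj₂ (inj₂ (dec , δ)) = descend dec (trans
    (cong (λ w → ∣ incr t ℤ.+ w ∣) δ) (∣i-1∣≡1+∣i∣ (incr t) (increase-nonpos (<⇒≤ t<k))))

  depth-bound : ∀ {t} → t ≤ k → depth t ≤ t
  depth-bound {zero} _ = z≤n
  depth-bound {suc t} t<k = ≤-trans (DepthStep-≤ (depth-step t<k)) (s≤s (depth-bound (<⇒≤ t<k)))

  depth-level : ∀ {t} → t ≤ k → shift n (φ (s t)) (depth t) ≡ φ a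
  depth-level {zero} _ = trans (ℤn.shift-zero _) (cong φ (ℤm.shift-zero a))
  depth-level {suc t} t<k = begin
    shift n (φ (s (suc t))) (depth (suc t))    ≡⟨ cong (λ w → shift n (φ w) (depth (suc t))) (ℤm.nxt-shift a t) ⟨
    shift n (φ (nxt m (s t))) (depth (suc t))  ≡⟨ DepthStep-level (depth-step t<k) ⟨
    shift n (φ (s t)) (depth t)                ≡⟨ depth-level (<⇒≤ t<k) ⟩
    φ a                                        ∎
    where open ≡-Reasoning

  depthAt : ℕ → ℕ
  depthAt t with t ≤? k
  ... | yes _ = depth t
  ... | no _ = 0

  depthAt-≤ : ∀ {t} → t ≤ k → depthAt t ≡ depth t
  depthAt-≤ {t} t≤k with t ≤? k
  ... | yes _ = refl
  ... | no t≰k = contradiction t≤k t≰k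

  depthAt-≥ : ∀ {t} → k ≤ t → depthAt t ≡ 0
  depthAt-≥ {t} k≤t with t ≤? k
  ... | yes t≤k = trans (cong depth (≤-antisym t≤k k≤t)) (cong ∣_∣ (proj₁ (proj₂ cutback)))
  ... | no _ = refl

  depthAt-bound : ∀ t → depthAt t ≤ k
  depthAt-bound t with t ≤? k
  ... | yes t≤k = ≤-trans (depth-bound t≤k) t≤k
  ... | no _ = z≤n

  depthAt-pos⇒≤ : ∀ {t} → 0 < depthAt t → t ≤ k
  depthAt-pos⇒≤ {t} pos with t ≤? k
  ... | yes t≤k = t≤k
  ... | no _ = contradiction pos (<-irrefl refl)

  depthOf : Fin m → ℕ
  depthOf u = depthAt (ℤm.offset a u)

  offset-s : ∀ {t} → t ≤ k → ℤm.offset a (s t) ≡ t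
  offset-s {t} t≤k = trans (ℤm.offset-shift a t) (m<n⇒m%n≡m (≤-<-trans t≤k k<m))

  depthOf-s : ∀ {t} → t ≤ k → depthOf (s t) ≡ depth t
  depthOf-s t≤k = trans (cong depthAt (offset-s t≤k)) (depthAt-≤ t≤k)

  onPath⇒offset≤ : ∀ {u} → OnPath m a k u → ℤm.offset a u ≤ k
  onPath⇒offset≤ (t , t≤k , refl) = subst (_≤ k) (sym (offset-s t≤k)) t≤k

  depthOf-level : ∀ {u} → ℤm.offset a u ≤ k → shift n (φ u) (depthOf u) ≡ φ a
  depthOf-level {u} t≤k =
    subst (λ w → shift n (φ w) (depthOf w) ≡ φ a) (ℤm.shift-offset a u)
      (trans (cong (shift n _) (depthOf-s t≤k)) (depth-level t≤k))

  depthOf-nxt-beyond : ∀ {u} → k ≤ ℤm.offset a u → depthOf (nxt m u) ≡ 0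
  depthOf-nxt-beyond {u} k≤t =
    trans (cong depthAt (ℤm.offset-nxt a u)) (beyond (m≤n⇒m<n∨m≡n (ℤm.offset<N a u)))
    where
      t = ℤm.offset a u
      beyond : suc t < m ⊎ suc t ≡ m → depthAt (suc t % m) ≡ 0
      beyond (inj₁ t+1<m) = trans (cong depthAt (m<n⇒m%n≡m t+1<m)) (depthAt-≥ (≤-trans k≤t (n≤1+n t)))
      beyond (inj₂ t+1≡m) = trans (cong depthAt (trans (cong (_% m) t+1≡m) (n%n≡0 m))) (depthAt-≤ z≤n)

  compatible : ∀ u → Compatible (φ u) (φ (nxt m u)) (depthOf u) (depthOf (nxt m u))
  compatible u with ℤm.offset a u <? k
  ... | yes t<k = subst (λ w → Compatible (φ w) (φ (nxt m w)) (depthOf w) (depthOf (nxt m w)))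
    (ℤm.shift-offset a u)
    (inj₂ (subst₂ (DepthStep _ _) (sym (depthOf-s (<⇒≤ t<k)))
      (sym (trans (cong depthOf (ℤm.nxt-shift a _)) (depthOf-s t<k))) (depth-step t<k)))
  ... | no t≮k = inj₁ (depthAt-≥ (≮⇒≥ t≮k) , depthOf-nxt-beyond (≮⇒≥ t≮k))

  clip : ℕ → Fin m → Fin n
  clip j u = shift n (φ u) (depthOf u ∸ j)

  clip-hom : ∀ j → IsHom m n dC dD (clip j)
  clip-hom j u .u (inj₁ refl) = inj₁ refl
  clip-hom j u _ e@(inj₂ (inj₁ (refl , _))) =
    Edge-MergedOrFixed {dD = dD} (hom _ _ e) (clip-compatible j (compatible u))
  clip-hom j _ v e@(inj₂ (inj₂ (refl , _))) =
    Edge-MergedOrFixed {dD = dD} (hom _ _ e) (clip-compatible j (Compatible-sym (compatible v)))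

  clip-moves : ∀ j w → (clip j w ≡ clip (suc j) w)
                     ⊎ (clip (suc j) w ≡ back^ (suc j) (φ a) × clip j w ≡ nxt n (back^ (suc j) (φ a)))
  clip-moves j w with depthOf w ≤? j
  ... | yes D≤j = inj₁ (trans (shift-zero-∸ (φ w) D≤j)
                              (sym (shift-zero-∸ (φ w) (≤-trans D≤j (n≤1+n j)))))
  ... | no D≰j = inj₂ (lower , upper)
    where
      open ≡-Reasoning
      D = depthOf w
      j<D : j < D
      j<D = ≰⇒> D≰j
      lower : clip (suc j) w ≡ back^ (suc j) (φ a)
      lower = ℤn.shift⇒back^ (begin
        shift n (shift n (φ w) (D ∸ suc j)) (suc j)  ≡⟨ ℤn.shift-shift (φ w) (D ∸ suc j) (suc j) ⟩
        shift n (φ w) (D ∸ suc j + suc j)            ≡⟨ cong (shift n (φ w)) (m∸n+n≡m j<D) ⟩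
        shift n (φ w) D                              ≡⟨ depthOf-level (depthAt-pos⇒≤ (≤-<-trans z≤n j<D)) ⟩
        φ a                                          ∎)
      upper : clip j w ≡ nxt n (back^ (suc j) (φ a))
      upper = begin
        shift n (φ w) (D ∸ j)            ≡⟨ cong (shift n (φ w)) (+-∸-assoc 1 j<D) ⟩
        shift n (φ w) (suc (D ∸ suc j))  ≡⟨ ℤn.nxt-shift (φ w) (D ∸ suc j) ⟨
        nxt n (clip (suc j) w)           ≡⟨ cong (nxt n) lower ⟩
        nxt n (back^ (suc j) (φ a))      ∎

  clip-upEdge : ∀ j → UpEdge m n dC dD (clip (suc j)) (clip j)
  clip-upEdge j =
    uniform-upEdge m n dC dD (clip-hom (suc j)) (clip-hom j) (back^ (suc j) (φ a)) (clip-moves j)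

  clip-top : ∀ w → clip k w ≡ φ w
  clip-top w = shift-zero-∸ (φ w) (depthAt-bound (ℤm.offset a w))

  clip-bottom : (φ′ : Fin m → Fin n) →
                (∀ u → OnPath m a k u → φ′ u ≡ φ a) →
                (∀ u → ¬ OnPath m a k u → φ′ u ≡ φ u) →
                ∀ w → φ′ w ≡ clip 0 w
  clip-bottom φ′ on off w = by-cases (ℤm.offset a w ≤? k)
    where
      by-cases : Dec (ℤm.offset a w ≤ k) → φ′ w ≡ clip 0 w
      by-cases (yes t≤k) = trans (on w (_ , t≤k , ℤm.shift-offset a w)) (sym (depthOf-level t≤k))
      by-cases (no t≰k) = trans (off w (λ p → t≰k (onPath⇒offset≤ p)))
        (sym (shift-zero-∸ (φ w) (≤-reflexive (depthAt-≥ (<⇒≤ (≰⇒> t≰k))))))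

lemma2p2 : (m n : ℕ) .{{_ : NonZero m}} .{{_ : NonZero n}}
    (dC : Fin m → Bool) (dD : Fin n → Bool) →
    3 ≤ m → 3 ≤ n → NonContractible n dD →
    (φ : Fin m → Fin n) → IsHom m n dC dD φ →
    (a : Fin m) (k : ℕ) → Cutback m n φ a k →
    (φ' : Fin m → Fin n) →
    (∀ u → OnPath m a k u → φ' u ≡ φ a) →
    (∀ u → ¬ OnPath m a k u → φ' u ≡ φ u) →
    UpPath m n dC dD φ φ'
lemma2p2 m n dC dD _ _ _ φ hom a k cutback φ' onPath offPath =
  step (≗-upEdge m n dC dD hom clip-top)
       (UpPath-++ m n dC dD (descending-upPath m n dC dD clip clip-upEdge k)
                            (step (≗-upEdge m n dC dD (clip-hom 0) (clip-bottom φ' onPath offPath)) done))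
  where open Cutback-flattening m n dC dD φ hom a k cutback
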